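{- Let $\mathcal{H}$ be a $3$-graph and let $\mathcal{H}_t$ be the $3$-graph obtained from $\mathcal{H}$ by applying Algorithm 1 (described in the context). Let $T\subset V(\mathcal{H}_t)$ contain exactly one vertex from each equivalence class of $\mathcal{H}_t$. Then (a) $|\mathcal{H}_t|\ge|\mathcal{H}|$; and (b) $\mathcal{H}_t[T]$ is $2$-covered and $\mathcal{H}_t$ is a blowup of $\mathcal{H}_t[T]$.
   Context: For a $3$-graph $\mathcal{H}$ and vertex $v$, the link is $L(v)=\{\{a,b\}: \{v,a,b\}\in\mathcal{H}\}$ and $d(v)=|L(v)|$. Two vertices are adjacent if some edge contains both. Two non-adjacent vertices $u,v$ are equivalent if $L(u)=L(v)$; $C_v$ denotes the equivalence class of $v$ (including $v$). Algorithm 1: while there exist two non-adjacent, non-equivalent vertices, pick such $u,v$ with $d(u)\ge d(v)$, delete all vertices of $C_v$ (with their edges) and add $|C_v|$ new vertices (labelled by the labels of $C_v$), each a copy of $u$; i.e. remove all edges meeting $C_v$ and for each edge $E\ni u$ and each $v'\in C_v$ add $(E\setminus\{u\})\cup\{v'\}$. Stop when no non-adjacent non-equivalent pair exists; the result is $\mathcal{H}_t$. $\mathcal{H}_t[T]$ is the induced subgraph on $T$. A $3$-graph is $2$-covered if every pair of its vertices lies in some edge. A blowup of a $3$-graph $\mathcal{T}$ on vertex set $\{1,\dots,s\}$ replaces each vertex $i$ by a nonempty set $V_i$ (pairwise disjoint) and each edge $\{i,j,k\}$ by all triples with one vertex in each of $V_i,V_j,V_k$. -}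

module Defs where

open import Data.Nat using (ℕ; zero; suc; _+_; _≤_)
open import Data.Bool using (Bool; true; false; not; _∧_; if_then_else_)
open import Data.Fin using (Fin)
open import Data.Vec using (Vec; []; _∷_; lookup)
open import Data.List using (List; []; _∷_; _++_; map)
open import Data.Nat.ListAction using (sum)
open import Data.Fin.Subset using (Subset; _∈_; _∉_; _⊆_; _∪_; _-_; ⁅_⁆; ∣_∣)
open import Data.Product using (Σ; _×_; _,_)
open import Data.Sum using (_⊎_)
open import Relation.Binary.PropositionalEquality using (_≡_; _≢_)
open import Relation.Nullary using (¬_)
open import Relation.Binary.Construct.Closure.ReflexiveTransitive using (Star)
open import Function.Bundles using (_⇔_)

HG : ℕ → Set
HG n = Subset n → Bool

Is3Graph : ∀ {n} → HG n → Set
Is3Graph {n} H = (S : Subset n) → H S ≡ true → ∣ S ∣ ≡ 3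

allSubsets : (n : ℕ) → List (Subset n)
allSubsets zero = [] ∷ []
allSubsets (suc n) = map (false ∷_) (allSubsets n) ++ map (true ∷_) (allSubsets n)

countSub : ∀ {n} → (Subset n → Bool) → ℕ
countSub {n} p = sum (map (λ S → if p S then 1 else 0) (allSubsets n))

size : ∀ {n} → HG n → ℕ
size H = countSub H

-- link indicator: P ∈ L(v) iff v ∉ P and P ∪ {v} is an edge
-- (for a 3-graph, P is then a pair {a,b} with {v,a,b} ∈ H)
linkB : ∀ {n} → HG n → Fin n → Subset n → Bool
linkB H v P = not (lookup P v) ∧ H (P ∪ ⁅ v ⁆)

deg : ∀ {n} → HG n → Fin n → ℕ
deg H v = countSub (linkB H v)

Adj : ∀ {n} → HG n → Fin n → Fin n → Set
Adj {n} H u v = Σ (Subset n) λ S → H S ≡ true × u ∈ S × v ∈ S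

SameLink : ∀ {n} → HG n → Fin n → Fin n → Set
SameLink {n} H u v = (P : Subset n) → linkB H u P ≡ linkB H v P

Equiv : ∀ {n} → HG n → Fin n → Fin n → Set
Equiv H u v = u ≢ v × ¬ Adj H u v × SameLink H u v

InClass : ∀ {n} → HG n → Fin n → Fin n → Set
InClass H v w = w ≡ v ⊎ Equiv H v w

-- one iteration of Algorithm 1 with the choice (u , v):
-- delete C_v with its edges, and make every v' ∈ C_v a copy of u.
StepWith : ∀ {n} → HG n → Fin n → Fin n → HG n → Set
StepWith {n} H u v H' =
  u ≢ v × ¬ Adj H u v × ¬ Equiv H u v × deg H v ≤ deg H u ×
  ((S : Subset n) →
     (H' S ≡ true) ⇔
     ((H S ≡ true × ((w : Fin n) → w ∈ S → ¬ InClass H v w))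
      ⊎ Σ (Subset n) λ E → H E ≡ true × u ∈ E ×
          Σ (Fin n) λ v' → InClass H v v' × S ≡ (E - u) ∪ ⁅ v' ⁆))

Step : ∀ {n} → HG n → HG n → Set
Step {n} H H' = Σ (Fin n) λ u → Σ (Fin n) λ v → StepWith H u v H'

Reaches : ∀ {n} → HG n → HG n → Set
Reaches = Star Step

Stopped : ∀ {n} → HG n → Set
Stopped {n} H = (u v : Fin n) → u ≢ v → ¬ Adj H u v → Equiv H u v

IsTransversal : ∀ {n} → HG n → Subset n → Set
IsTransversal {n} H T =
  ((x : Fin n) → Σ (Fin n) λ t → t ∈ T × InClass H x t) ×
  ((t t' : Fin n) → t ∈ T → t' ∈ T → InClass H t t' → t ≡ t')

Induced : ∀ {n} → HG n → Subset n → Subset n → Set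
Induced H T S = H S ≡ true × S ⊆ T

TwoCovered : ∀ {n} → Subset n → (Subset n → Set) → Set
TwoCovered {n} T G = (a b : Fin n) → a ∈ T → b ∈ T → a ≢ b →
  Σ (Subset n) λ S → G S × a ∈ S × b ∈ S

-- H (on Fin n) is a blowup of G (a 3-graph on vertex set T ⊆ Fin n):
-- f assigns each vertex of H to its part V_i (i ∈ T); parts are disjoint
-- (f is a function), cover Fin n, and are nonempty; the edges of H are
-- exactly the triples meeting each of V_i, V_j, V_k once for an edge {i,j,k} of G.
IsBlowupOf : ∀ {n} → HG n → Subset n → (Subset n → Set) → Set
IsBlowupOf {n} H T G =
  Σ (Fin n → Fin n) λ f →
    ((x : Fin n) → f x ∈ T) ×
    ((i : Fin n) → i ∈ T → Σ (Fin n) λ x → f x ≡ i) ×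
    ((S : Subset n) →
       (H S ≡ true) ⇔
       (Σ (Subset n) λ E → G E × ∣ E ∣ ≡ 3 × ∣ S ∣ ≡ 3 ×
          ((x : Fin n) → x ∈ S → f x ∈ E) ×
          ((i : Fin n) → i ∈ E → Σ (Fin n) λ x → x ∈ S × f x ≡ i)))

module Submission where

-- (a) One step with choice (u , v) and class C = C_v keeps the edges avoiding
--     C, and every edge of the new graph H' meets C at most once.  Double
--     counting incidences between edges and C gives
--       |H|  ≤ #(edges of H avoiding C)  + Σ_{w ∈ C} d_H(w)
--       |H'| = #(edges of H' avoiding C) + Σ_{w ∈ C} d_H'(w),
--     and d_H(w) = d_H(v) ≤ d_H(u) = d_H'(w) because each w ∈ C becomes a
--     copy of u.  Steps also keep H a 3-graph, so (a) follows along the run.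
-- (b) In a stopped 3-graph, replacing a vertex of an edge by a vertex with
--     the same link gives an edge again.  Sending every vertex to its class
--     representative in T therefore maps edges {x,y,z} to edges of Ht[T] and
--     back; this is the blowup.  Two distinct vertices of T are not
--     equivalent, hence (the graph being stopped) adjacent, which gives
--     2-coverage.

open import Defs
open import Data.Nat using (ℕ; zero; suc; _+_; _≤_; z≤n; s≤s)
open import Data.Nat.Properties
  using (≤-refl; ≤-trans; ≤-reflexive; +-comm; +-mono-≤; n≤1+n;
         suc-injective; +-0-commutativeMonoid; +-commutativeSemigroup; module ≤-Reasoning)
open import Data.Bool using (Bool; true; false; not; _∧_; if_then_else_)
open import Data.Bool.Properties using (∧-zeroʳ; ∧-identityʳ; ⇔→≡)
  renaming (_≟_ to _≟ᵇ_)
open import Data.Fin using (Fin; zero; suc)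
open import Data.Fin.Properties using (_≟_)
open import Data.Vec using ([]; _∷_; lookup; tabulate; here; there)
open import Data.Vec.Properties using ([]=⇒lookup; lookup⇒[]=; lookup-zipWith; lookup∘tabulate)
open import Data.List using (List; _++_; map)
open import Data.List.Properties using (map-++; map-∘)
open import Data.Nat.ListAction using (sum)
open import Data.Nat.ListAction.Properties using (sum-++)
open import Data.Fin.Subset
  using (Subset; _∈_; _∉_; _⊆_; _∪_; _∩_; _─_; _-_; ⁅_⁆; ∣_∣; ⊥; Nonempty; Empty)
open import Data.Fin.Subset.Properties
  using (x∈⁅x⁆; x∈⁅y⁆⇒x≡y; x≢y⇒x∉⁅y⁆; ∣⁅x⁆∣≡1; ∣⊥∣≡0; x∈p∪q⁺; x∈p∪q⁻; x∈p∩q⁺; x∈p∩q⁻;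
         x∈p∧x≢y⇒x∈p-y; p─q⊆p; x∈p⇒∣p-x∣<∣p∣; p⊆q⇒∣p∣≤∣q∣; ⊆-antisym;
         ∪-identityʳ; ∪-identityˡ; ∪-idem; Empty-unique; nonempty?; anySubset?; _∈?_;
         drop-there)
open import Data.Product using (Σ; _×_; _,_; proj₁; proj₂)
open import Data.Sum using (_⊎_; inj₁; inj₂)
open import Data.Empty using (⊥-elim)
open import Relation.Binary.PropositionalEquality
  using (_≡_; _≢_; refl; sym; trans; cong; cong₂; subst)
open import Level using (0ℓ)
open import Relation.Unary using (Pred; Decidable)
open import Relation.Nullary using (¬_; Dec; yes; no; does; ¬?; _×-dec_; _⊎-dec_)
open import Relation.Nullary.Decidable using (decidable-stable; map′)
open import Relation.Binary.Construct.Closure.ReflexiveTransitive using (ε; _◅_)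
open import Function.Bundles using (_⇔_; mk⇔; Equivalence)
open import Function using (_∘_)
open import Algebra.Properties.CommutativeMonoid.Sum +-0-commutativeMonoid
  using (sum-syntax; sum-cong-≗)
open import Algebra.Properties.CommutativeSemigroup +-commutativeSemigroup
  using (interchange)

⟦_⟧ : Bool → ℕ
⟦ b ⟧ = if b then 1 else 0

Σs : ∀ {n} → (Subset n → ℕ) → ℕ
Σs {zero} f = f []
Σs {suc n} f = Σs (λ S → f (false ∷ S)) + Σs (λ S → f (true ∷ S))

countSub≡Σs : ∀ {n} (p : Subset n → Bool) → countSub p ≡ Σs (λ S → ⟦ p S ⟧)
countSub≡Σs p = list-sum (λ S → ⟦ p S ⟧)
  where
  sum-map-++ : ∀ {A : Set} (f : A → ℕ) (xs ys : List A) →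
               sum (map f (xs ++ ys)) ≡ sum (map f xs) + sum (map f ys)
  sum-map-++ f xs ys = trans (cong sum (map-++ f xs ys)) (sum-++ (map f xs) (map f ys))
  list-sum : ∀ {n} (f : Subset n → ℕ) → sum (map f (allSubsets n)) ≡ Σs f
  list-sum {zero} f = +-comm (f []) 0
  list-sum {suc n} f = trans (sum-map-++ f (map (false ∷_) A) (map (true ∷_) A))
    (cong₂ _+_ (trans (cong sum (sym (map-∘ A))) (list-sum (λ S → f (false ∷ S))))
               (trans (cong sum (sym (map-∘ A))) (list-sum (λ S → f (true ∷ S)))))
    where A = allSubsets n

Σs-cong : ∀ {n} {f g : Subset n → ℕ} → (∀ S → f S ≡ g S) → Σs f ≡ Σs g
Σs-cong {zero} f≗g = f≗g []
Σs-cong {suc n} f≗g = cong₂ _+_ (Σs-cong (f≗g ∘ (false ∷_))) (Σs-cong (f≗g ∘ (true ∷_)))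

countSub-cong : ∀ {n} {p q : Subset n → Bool} → (∀ S → p S ≡ q S) → countSub p ≡ countSub q
countSub-cong {p = p} {q} p≗q =
  trans (countSub≡Σs p) (trans (Σs-cong (cong ⟦_⟧ ∘ p≗q)) (sym (countSub≡Σs q)))

Σs-mono : ∀ {n} {f g : Subset n → ℕ} → (∀ S → f S ≤ g S) → Σs f ≤ Σs g
Σs-mono {zero} f≤g = f≤g []
Σs-mono {suc n} f≤g = +-mono-≤ (Σs-mono (f≤g ∘ (false ∷_))) (Σs-mono (f≤g ∘ (true ∷_)))

Σs-zero : ∀ {n} → Σs {n} (λ _ → 0) ≡ 0
Σs-zero {zero} = refl
Σs-zero {suc n} = cong₂ _+_ (Σs-zero {n}) (Σs-zero {n})

Σs-distrib-+ : ∀ {n} (f g : Subset n → ℕ) → Σs (λ S → f S + g S) ≡ Σs f + Σs g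
Σs-distrib-+ {zero} f g = refl
Σs-distrib-+ {suc n} f g =
  trans (cong₂ _+_ (Σs-distrib-+ (f ∘ (false ∷_)) (g ∘ (false ∷_)))
                   (Σs-distrib-+ (f ∘ (true ∷_)) (g ∘ (true ∷_))))
        (interchange (Σs (f ∘ (false ∷_))) (Σs (g ∘ (false ∷_)))
                     (Σs (f ∘ (true ∷_))) (Σs (g ∘ (true ∷_))))

Σs-∑-comm : ∀ {n m} (h : Subset n → Fin m → ℕ) →
            Σs (λ S → ∑[ w < m ] h S w) ≡ ∑[ w < m ] Σs (λ S → h S w)
Σs-∑-comm {n} {zero} h = Σs-zero {n}
Σs-∑-comm {n} {suc m} h =
  trans (Σs-distrib-+ (λ S → h S zero) (λ S → ∑[ w < m ] h S (suc w)))
        (cong (Σs (λ S → h S zero) +_) (Σs-∑-comm (λ S w → h S (suc w))))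

-- toggle w S flips the membership of w; it is a bijection of Subset n.
toggle : ∀ {n} → Fin n → Subset n → Subset n
toggle zero (b ∷ S) = not b ∷ S
toggle (suc w) (b ∷ S) = b ∷ toggle w S

Σs-toggle : ∀ {n} (w : Fin n) (f : Subset n → ℕ) → Σs (λ S → f (toggle w S)) ≡ Σs f
Σs-toggle zero f = +-comm (Σs (λ S → f (true ∷ S))) (Σs (λ S → f (false ∷ S)))
Σs-toggle (suc w) f =
  cong₂ _+_ (Σs-toggle w (f ∘ (false ∷_))) (Σs-toggle w (f ∘ (true ∷_)))

∑-zero : ∀ m → ∑[ w < m ] 0 ≡ 0
∑-zero zero = refl
∑-zero (suc m) = ∑-zero m

∑-mono : ∀ {m} {f g : Fin m → ℕ} → (∀ w → f w ≤ g w) → ∑[ w < m ] f w ≤ ∑[ w < m ] g w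
∑-mono {zero} f≤g = z≤n
∑-mono {suc m} f≤g = +-mono-≤ (f≤g zero) (∑-mono (f≤g ∘ suc))

∈⇒lookup : ∀ {n} {x : Fin n} {p : Subset n} → x ∈ p → lookup p x ≡ true
∈⇒lookup = []=⇒lookup

lookup⇒∈ : ∀ {n} {x : Fin n} {p : Subset n} → lookup p x ≡ true → x ∈ p
lookup⇒∈ {x = x} {p} = lookup⇒[]= x p

∉⇒lookup : ∀ {n} {x : Fin n} {p : Subset n} → x ∉ p → lookup p x ≡ false
∉⇒lookup {x = x} {p} x∉p with lookup p x in e
... | true = ⊥-elim (x∉p (lookup⇒∈ e))
... | false = refl

lookup⇒∉ : ∀ {n} {x : Fin n} {p : Subset n} → lookup p x ≡ false → x ∉ p
lookup⇒∉ e x∈p with trans (sym (∈⇒lookup x∈p)) e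
... | ()

subsetOf : ∀ {n} {P : Pred (Fin n) 0ℓ} → Decidable P → Subset n
subsetOf P? = tabulate (does ∘ P?)

∈subsetOf⁻ : ∀ {n} {P : Pred (Fin n) 0ℓ} (P? : Decidable P) {x} → x ∈ subsetOf P? → P x
∈subsetOf⁻ P? {x} x∈ with P? x | trans (sym (lookup∘tabulate (does ∘ P?) x)) (∈⇒lookup x∈)
... | yes Px | _ = Px
... | no _ | ()

∈subsetOf⁺ : ∀ {n} {P : Pred (Fin n) 0ℓ} (P? : Decidable P) {x} → P x → x ∈ subsetOf P?
∈subsetOf⁺ P? {x} Px with P? x | lookup∘tabulate (does ∘ P?) x
... | yes _ | e = lookup⇒∈ e
... | no ¬Px | _ = ⊥-elim (¬Px Px)

x∈p─q⁻ : ∀ {n} {x : Fin n} (p q : Subset n) → x ∈ p ─ q → x ∈ p × x ∉ q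
x∈p─q⁻ {x = zero} (true ∷ p) (false ∷ q) here = here , λ ()
x∈p─q⁻ {x = zero} (false ∷ p) (true ∷ q) ()
x∈p─q⁻ {x = zero} (false ∷ p) (false ∷ q) ()
x∈p─q⁻ {x = zero} (true ∷ p) (true ∷ q) ()
x∈p─q⁻ {x = suc _} (_ ∷ p) (_ ∷ q) (there x∈) with x∈p─q⁻ p q x∈
... | x∈p , x∉q = there x∈p , x∉q ∘ drop-there

x∉p-x : ∀ {n} (p : Subset n) (x : Fin n) → x ∉ p - x
x∉p-x p x x∈ = proj₂ (x∈p─q⁻ p ⁅ x ⁆ x∈) (x∈⁅x⁆ x)

x∈p∪⁅x⁆ : ∀ {n} (p : Subset n) (x : Fin n) → x ∈ p ∪ ⁅ x ⁆
x∈p∪⁅x⁆ p x = x∈p∪q⁺ (inj₂ (x∈⁅x⁆ x))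

∈p∪⁅x⁆ : ∀ {n} {p : Subset n} {y : Fin n} (x : Fin n) → y ∈ p → y ∈ p ∪ ⁅ x ⁆
∈p∪⁅x⁆ x y∈p = x∈p∪q⁺ (inj₁ y∈p)

∈p∪⁅x⁆⁻ : ∀ {n} (p : Subset n) {x y : Fin n} → y ∈ p ∪ ⁅ x ⁆ → y ∈ p ⊎ y ≡ x
∈p∪⁅x⁆⁻ p {x} y∈ with x∈p∪q⁻ p ⁅ x ⁆ y∈
... | inj₁ y∈p = inj₁ y∈p
... | inj₂ y∈x = inj₂ (x∈⁅y⁆⇒x≡y x y∈x)

p-x∪x : ∀ {n} {p : Subset n} {x} → x ∈ p → (p - x) ∪ ⁅ x ⁆ ≡ p
p-x∪x {p = p} {x} x∈p = ⊆-antisym sub sup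
  where
  sub : (p - x) ∪ ⁅ x ⁆ ⊆ p
  sub y∈ with ∈p∪⁅x⁆⁻ (p - x) y∈
  ... | inj₁ y∈p-x = p─q⊆p p ⁅ x ⁆ y∈p-x
  ... | inj₂ refl = x∈p
  sup : p ⊆ (p - x) ∪ ⁅ x ⁆
  sup {y} y∈p with y ≟ x
  ... | yes refl = x∈p∪⁅x⁆ (p - x) y
  ... | no y≢x = ∈p∪⁅x⁆ x (x∈p∧x≢y⇒x∈p-y y∈p y≢x)

p∪x-x : ∀ {n} {p : Subset n} {x} → x ∉ p → (p ∪ ⁅ x ⁆) - x ≡ p
p∪x-x {p = p} {x} x∉p = ⊆-antisym sub sup
  where
  sub : (p ∪ ⁅ x ⁆) - x ⊆ p
  sub {y} y∈ with x∈p─q⁻ (p ∪ ⁅ x ⁆) ⁅ x ⁆ y∈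
  ... | y∈p∪x , y∉x with ∈p∪⁅x⁆⁻ p y∈p∪x
  ... | inj₁ y∈p = y∈p
  ... | inj₂ refl = ⊥-elim (y∉x (x∈⁅x⁆ y))
  sup : p ⊆ (p ∪ ⁅ x ⁆) - x
  sup {y} y∈p = x∈p∧x≢y⇒x∈p-y (∈p∪⁅x⁆ x y∈p) (λ { refl → x∉p y∈p })

∪⁅x⁆-cancel : ∀ {n} {p q : Subset n} {x} → x ∉ p → x ∉ q → p ∪ ⁅ x ⁆ ≡ q ∪ ⁅ x ⁆ → p ≡ q
∪⁅x⁆-cancel {x = x} x∉p x∉q e =
  trans (sym (p∪x-x x∉p)) (trans (cong (_- x) e) (p∪x-x x∉q))

∪⁅x⁆-absorb : ∀ {n} {p : Subset n} {x} → x ∈ p → p ∪ ⁅ x ⁆ ≡ p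
∪⁅x⁆-absorb {p = p} {x} x∈p = ⊆-antisym sub (∈p∪⁅x⁆ x)
  where
  sub : p ∪ ⁅ x ⁆ ⊆ p
  sub y∈ with ∈p∪⁅x⁆⁻ p y∈
  ... | inj₁ y∈p = y∈p
  ... | inj₂ refl = x∈p

∣p∪⁅x⁆∣≡1+∣p∣ : ∀ {n} (p : Subset n) {x} → x ∉ p → ∣ p ∪ ⁅ x ⁆ ∣ ≡ suc ∣ p ∣
∣p∪⁅x⁆∣≡1+∣p∣ (true ∷ p) {zero} x∉p = ⊥-elim (x∉p here)
∣p∪⁅x⁆∣≡1+∣p∣ (false ∷ p) {zero} _ = cong (suc ∘ ∣_∣) (∪-identityʳ p)
∣p∪⁅x⁆∣≡1+∣p∣ (true ∷ p) {suc x} x∉p = cong suc (∣p∪⁅x⁆∣≡1+∣p∣ p (x∉p ∘ there))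
∣p∪⁅x⁆∣≡1+∣p∣ (false ∷ p) {suc x} x∉p = ∣p∪⁅x⁆∣≡1+∣p∣ p (x∉p ∘ there)

∣p∪⁅x⁆∣≤1+∣p∣ : ∀ {n} (p : Subset n) x → ∣ p ∪ ⁅ x ⁆ ∣ ≤ suc ∣ p ∣
∣p∪⁅x⁆∣≤1+∣p∣ p x with x ∈? p
... | yes x∈p = ≤-trans (≤-reflexive (cong ∣_∣ (∪⁅x⁆-absorb x∈p))) (n≤1+n ∣ p ∣)
... | no x∉p = ≤-reflexive (∣p∪⁅x⁆∣≡1+∣p∣ p x∉p)

empty⇒∣p∣≡0 : ∀ {n} {p : Subset n} → Empty p → ∣ p ∣ ≡ 0
empty⇒∣p∣≡0 {n} empty = trans (cong ∣_∣ (Empty-unique empty)) (∣⊥∣≡0 n)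

∣p∣≤1 : ∀ {n} {p : Subset n} → (∀ {x y} → x ∈ p → y ∈ p → x ≡ y) → ∣ p ∣ ≤ 1
∣p∣≤1 {p = p} unique with nonempty? p
... | yes (x , x∈p) = ≤-trans (p⊆q⇒∣p∣≤∣q∣ p⊆⁅x⁆) (≤-reflexive (∣⁅x⁆∣≡1 x))
  where
  p⊆⁅x⁆ : p ⊆ ⁅ x ⁆
  p⊆⁅x⁆ y∈p = subst (_∈ ⁅ x ⁆) (unique x∈p y∈p) (x∈⁅x⁆ x)
... | no empty = ≤-trans (≤-reflexive (empty⇒∣p∣≡0 empty)) z≤n

nonempty⇒1≤∣p∣ : ∀ {n} {p : Subset n} → Nonempty p → 1 ≤ ∣ p ∣
nonempty⇒1≤∣p∣ (x , x∈p) = ≤-trans (s≤s z≤n) (x∈p⇒∣p-x∣<∣p∣ x∈p)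

∣p∣≡0⇒p≡⊥ : ∀ {n} {p : Subset n} → ∣ p ∣ ≡ 0 → p ≡ ⊥
∣p∣≡0⇒p≡⊥ ∣p∣≡0 = Empty-unique λ nonempty → 1≰0 (subst (1 ≤_) ∣p∣≡0 (nonempty⇒1≤∣p∣ nonempty))
  where
  1≰0 : ¬ 1 ≤ 0
  1≰0 ()

split-element : ∀ {n k} {S : Subset n} → ∣ S ∣ ≡ suc k →
                Σ (Fin n) λ x → Σ (Subset n) λ A → x ∉ A × S ≡ A ∪ ⁅ x ⁆ × ∣ A ∣ ≡ k
split-element {S = S} ∣S∣≡1+k with nonempty? S
... | yes (x , x∈S) =
  x , S - x , x∉p-x S x , sym (p-x∪x x∈S) ,
  suc-injective (trans (sym (∣p∪⁅x⁆∣≡1+∣p∣ (S - x) (x∉p-x S x)))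
                       (trans (cong ∣_∣ (p-x∪x x∈S)) ∣S∣≡1+k))
... | no empty with trans (sym (empty⇒∣p∣≡0 empty)) ∣S∣≡1+k
...   | ()

-- Triples {x,y,z}, written so that x is the element added last; this is
-- the shape P ∪ ⁅ x ⁆ in which the link of x sees the edge.
pair : ∀ {n} → Fin n → Fin n → Subset n
pair y z = ⁅ y ⁆ ∪ ⁅ z ⁆

triple : ∀ {n} → Fin n → Fin n → Fin n → Subset n
triple x y z = pair y z ∪ ⁅ x ⁆

Distinct : ∀ {n} → Fin n → Fin n → Fin n → Set
Distinct x y z = x ≢ y × x ≢ z × y ≢ z

∈pair⁻ : ∀ {n} {i y z : Fin n} → i ∈ pair y z → i ≡ y ⊎ i ≡ z
∈pair⁻ {y = y} {z} i∈ with x∈p∪q⁻ ⁅ y ⁆ ⁅ z ⁆ i∈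
... | inj₁ i∈y = inj₁ (x∈⁅y⁆⇒x≡y y i∈y)
... | inj₂ i∈z = inj₂ (x∈⁅y⁆⇒x≡y z i∈z)

y∈pair : ∀ {n} (y z : Fin n) → y ∈ pair y z
y∈pair y z = x∈p∪q⁺ (inj₁ (x∈⁅x⁆ y))

z∈pair : ∀ {n} (y z : Fin n) → z ∈ pair y z
z∈pair y z = x∈p∪q⁺ (inj₂ (x∈⁅x⁆ z))

∉pair : ∀ {n} {x y z : Fin n} → x ≢ y → x ≢ z → x ∉ pair y z
∉pair x≢y x≢z x∈ with ∈pair⁻ x∈
... | inj₁ x≡y = x≢y x≡y
... | inj₂ x≡z = x≢z x≡z

∈triple⁻ : ∀ {n} {i x y z : Fin n} → i ∈ triple x y z → i ≡ x ⊎ i ≡ y ⊎ i ≡ z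
∈triple⁻ {x = x} {y} {z} i∈ with ∈p∪⁅x⁆⁻ (pair y z) i∈
... | inj₂ i≡x = inj₁ i≡x
... | inj₁ i∈yz with ∈pair⁻ i∈yz
...   | inj₁ i≡y = inj₂ (inj₁ i≡y)
...   | inj₂ i≡z = inj₂ (inj₂ i≡z)

x∈triple : ∀ {n} (x y z : Fin n) → x ∈ triple x y z
x∈triple x y z = x∈p∪⁅x⁆ (pair y z) x

y∈triple : ∀ {n} (x y z : Fin n) → y ∈ triple x y z
y∈triple x y z = ∈p∪⁅x⁆ x (y∈pair y z)

z∈triple : ∀ {n} (x y z : Fin n) → z ∈ triple x y z
z∈triple x y z = ∈p∪⁅x⁆ x (z∈pair y z)

triple-map : ∀ {n} (f : Fin n → Fin n) {w x y z} → w ∈ triple x y z → f w ∈ triple (f x) (f y) (f z)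
triple-map f {x = x} {y} {z} w∈ with ∈triple⁻ w∈
... | inj₁ refl = x∈triple (f x) (f y) (f z)
... | inj₂ (inj₁ refl) = y∈triple (f x) (f y) (f z)
... | inj₂ (inj₂ refl) = z∈triple (f x) (f y) (f z)

triple-map⁻ : ∀ {n} (f : Fin n → Fin n) {i x y z} → i ∈ triple (f x) (f y) (f z) →
              Σ (Fin n) λ w → w ∈ triple x y z × f w ≡ i
triple-map⁻ f {x = x} {y} {z} i∈ with ∈triple⁻ i∈
... | inj₁ refl = x , x∈triple x y z , refl
... | inj₂ (inj₁ refl) = y , y∈triple x y z , refl
... | inj₂ (inj₂ refl) = z , z∈triple x y z , refl

triple-rotate : ∀ {n} (x y z : Fin n) → triple x y z ≡ triple y z x
triple-rotate x y z = ⊆-antisym (rot x y z) (rot z x y ∘ rot y z x)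
  where
  rot : ∀ a b c → triple a b c ⊆ triple b c a
  rot a b c i∈ with ∈triple⁻ i∈
  ... | inj₁ refl = z∈triple b c a
  ... | inj₂ (inj₁ refl) = x∈triple b c a
  ... | inj₂ (inj₂ refl) = y∈triple b c a

∣triple∣≡3 : ∀ {n} {x y z : Fin n} → Distinct x y z → ∣ triple x y z ∣ ≡ 3
∣triple∣≡3 {x = x} {y} {z} (x≢y , x≢z , y≢z) =
  trans (∣p∪⁅x⁆∣≡1+∣p∣ (pair y z) (∉pair x≢y x≢z))
        (cong suc (trans (∣p∪⁅x⁆∣≡1+∣p∣ ⁅ y ⁆ (x≢y⇒x∉⁅y⁆ (λ z≡y → y≢z (sym z≡y))))
                         (cong suc (∣⁅x⁆∣≡1 y))))

∣triple∣≡3⇒distinct : ∀ {n} {x y z : Fin n} → ∣ triple x y z ∣ ≡ 3 → Distinct x y z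
∣triple∣≡3⇒distinct {x = x} {y} {z} ∣xyz∣≡3 = x≢y , x≢z , y≢z
  where
  3≰2 : ∀ {k} → k ≡ 3 → ¬ k ≤ 2
  3≰2 refl (s≤s (s≤s ()))
  ∣pair∣≤2 : ∀ (a b : Fin _) → ∣ pair a b ∣ ≤ 2
  ∣pair∣≤2 a b = ≤-trans (∣p∪⁅x⁆∣≤1+∣p∣ ⁅ a ⁆ b) (≤-reflexive (cong suc (∣⁅x⁆∣≡1 a)))
  x∈pair⇒∣triple∣≤2 : x ∈ pair y z → ∣ triple x y z ∣ ≤ 2
  x∈pair⇒∣triple∣≤2 x∈ = ≤-trans (≤-reflexive (cong ∣_∣ (∪⁅x⁆-absorb x∈))) (∣pair∣≤2 y z)
  x≢y : x ≢ y
  x≢y refl = 3≰2 ∣xyz∣≡3 (x∈pair⇒∣triple∣≤2 (y∈pair y z))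
  x≢z : x ≢ z
  x≢z refl = 3≰2 ∣xyz∣≡3 (x∈pair⇒∣triple∣≤2 (z∈pair y z))
  y≢z : y ≢ z
  y≢z refl = 3≰2 ∣xyz∣≡3 (≤-trans (∣p∪⁅x⁆∣≤1+∣p∣ (pair y y) x)
                           (s≤s (≤-reflexive (trans (cong ∣_∣ (∪-idem ⁅ y ⁆)) (∣⁅x⁆∣≡1 y)))))

3-set⇒triple : ∀ {n} {S : Subset n} → ∣ S ∣ ≡ 3 →
               Σ (Fin n) λ x → Σ (Fin n) λ y → Σ (Fin n) λ z → Distinct x y z × S ≡ triple x y z
3-set⇒triple {S = S} ∣S∣≡3 with split-element ∣S∣≡3
... | x , A , _ , S≡A∪x , ∣A∣≡2 with split-element ∣A∣≡2
...   | z , B , _ , A≡B∪z , ∣B∣≡1 with split-element ∣B∣≡1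
...     | y , C , _ , B≡C∪y , ∣C∣≡0 = x , y , z , ∣triple∣≡3⇒distinct (trans (cong ∣_∣ (sym S≡xyz)) ∣S∣≡3) , S≡xyz
  where
  B≡y : B ≡ ⁅ y ⁆
  B≡y = trans B≡C∪y (trans (cong (_∪ ⁅ y ⁆) (∣p∣≡0⇒p≡⊥ ∣C∣≡0)) (∪-identityˡ ⁅ y ⁆))
  S≡xyz : S ≡ triple x y z
  S≡xyz = trans S≡A∪x (cong (_∪ ⁅ x ⁆) (trans A≡B∪z (cong (_∪ ⁅ z ⁆) B≡y)))

link⁻ : ∀ {n} {X : HG n} {v P} → linkB X v P ≡ true → v ∉ P × X (P ∪ ⁅ v ⁆) ≡ true
link⁻ {v = v} {P} inLink with lookup P v in v∈?P
... | false = lookup⇒∉ v∈?P , inLink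

link⁺ : ∀ {n} {X : HG n} {v P} → v ∉ P → X (P ∪ ⁅ v ⁆) ≡ true → linkB X v P ≡ true
link⁺ v∉P edge rewrite ∉⇒lookup v∉P = edge

edge∈link : ∀ {n} {X : HG n} {S v} → X S ≡ true → v ∈ S → linkB X v (S - v) ≡ true
edge∈link {X = X} {S} {v} edge v∈S =
  link⁺ {X = X} (x∉p-x S v) (subst (λ E → X E ≡ true) (sym (p-x∪x v∈S)) edge)

sameLink-sym : ∀ {n} {X : HG n} {a b} → SameLink X a b → SameLink X b a
sameLink-sym a~b P = sym (a~b P)

equiv-sym : ∀ {n} {X : HG n} {a b} → Equiv X a b → Equiv X b a
equiv-sym {X = X} (a≢b , a≁b , a~b) =
  (λ b≡a → a≢b (sym b≡a)) , (λ { (E , edge , b∈ , a∈) → a≁b (E , edge , a∈ , b∈) }) , sameLink-sym {X = X} a~b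

inClass⇒sameLink : ∀ {n} {X : HG n} {v w} → InClass X v w → SameLink X v w
inClass⇒sameLink (inj₁ refl) P = refl
inClass⇒sameLink (inj₂ (_ , _ , v~w)) = v~w

sameLink⇒deg≡ : ∀ {n} {X : HG n} {a b} → SameLink X a b → deg X a ≡ deg X b
sameLink⇒deg≡ a~b = countSub-cong a~b

replace-rotate : ∀ {n} {X : HG n} {x y z x'} → X (triple x y z) ≡ true → Distinct x y z →
                 SameLink X x x' → X (triple y z x') ≡ true × Distinct y z x'
replace-rotate {X = X} {x} {y} {z} {x'} edge (x≢y , x≢z , y≢z) x~x' =
  subst (λ E → X E ≡ true) (triple-rotate x' y z) (proj₂ x'-link) ,
  (y≢z , (λ { refl → proj₁ x'-link (y∈pair y z) }) , (λ { refl → proj₁ x'-link (z∈pair y z) }))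
  where
  x'-link : x' ∉ pair y z × X (triple x' y z) ≡ true
  x'-link = link⁻ {X = X} (trans (sym (x~x' (pair y z))) (link⁺ {X = X} (∉pair x≢y x≢z) edge))

replace-all : ∀ {n} {X : HG n} {x y z x' y' z'} → X (triple x y z) ≡ true → Distinct x y z →
              SameLink X x x' → SameLink X y y' → SameLink X z z' →
              X (triple x' y' z') ≡ true × Distinct x' y' z'
replace-all {X = X} edge distinct x~x' y~y' z~z' with replace-rotate {X = X} edge distinct x~x'
... | edge₁ , distinct₁ with replace-rotate {X = X} edge₁ distinct₁ y~y'
...   | edge₂ , distinct₂ = replace-rotate {X = X} edge₂ distinct₂ z~z'

adjacent? : ∀ {n} (X : HG n) u v → Dec (Adj X u v)
adjacent? X u v = anySubset? (λ S → (X S ≟ᵇ true) ×-dec (u ∈? S) ×-dec (v ∈? S))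

sameLink? : ∀ {n} (X : HG n) u v → Dec (SameLink X u v)
sameLink? X u v =
  map′ (λ noDifference P → decidable-stable (linkB X u P ≟ᵇ linkB X v P) (λ ≢ → noDifference (P , ≢)))
       (λ u~v (P , ≢) → ≢ (u~v P))
       (¬? (anySubset? (λ P → ¬? (linkB X u P ≟ᵇ linkB X v P))))

inClass? : ∀ {n} (X : HG n) v w → Dec (InClass X v w)
inClass? X v w = (w ≟ v) ⊎-dec (¬? (v ≟ w) ×-dec ¬? (adjacent? X v w) ×-dec sameLink? X v w)

-- The degree of w counts the edges through w: the toggle at w matches
-- the link sets P (w ∉ P) with the edges P ∪ {w}.
deg≡edges-through : ∀ {n} (X : HG n) (w : Fin n) → deg X w ≡ Σs (λ S → ⟦ lookup S w ∧ X S ⟧)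
deg≡edges-through X w =
  trans (countSub≡Σs (linkB X w))
        (trans (sym (Σs-toggle w (λ P → ⟦ linkB X w P ⟧))) (Σs-cong (cong ⟦_⟧ ∘ link-of-toggle)))
  where
  lookup-toggle : ∀ {n} (w : Fin n) S → lookup (toggle w S) w ≡ not (lookup S w)
  lookup-toggle zero (b ∷ S) = refl
  lookup-toggle (suc w) (b ∷ S) = lookup-toggle w S
  toggle∪⁅w⁆ : ∀ {n} (w : Fin n) S → lookup S w ≡ true → toggle w S ∪ ⁅ w ⁆ ≡ S
  toggle∪⁅w⁆ zero (true ∷ S) _ = cong (true ∷_) (∪-identityʳ S)
  toggle∪⁅w⁆ (suc w) (true ∷ S) w∈S = cong (true ∷_) (toggle∪⁅w⁆ w S w∈S)
  toggle∪⁅w⁆ (suc w) (false ∷ S) w∈S = cong (false ∷_) (toggle∪⁅w⁆ w S w∈S)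
  link-of-toggle : ∀ S → linkB X w (toggle w S) ≡ lookup S w ∧ X S
  link-of-toggle S with lookup S w in w∈?S
  ... | true rewrite lookup-toggle w S | w∈?S | toggle∪⁅w⁆ w S w∈?S = refl
  ... | false rewrite lookup-toggle w S | w∈?S = refl

∣p∣≡∑ : ∀ {n} (p : Subset n) → ∣ p ∣ ≡ ∑[ w < n ] ⟦ lookup p w ⟧
∣p∣≡∑ [] = refl
∣p∣≡∑ (true ∷ p) = cong suc (∣p∣≡∑ p)
∣p∣≡∑ (false ∷ p) = ∣p∣≡∑ p

incidences : ∀ {n} → HG n → Subset n → Subset n → ℕ
incidences {n} X C S = ∑[ w < n ] ⟦ lookup (C ∩ S) w ∧ X S ⟧

degSum : ∀ {n} → HG n → Subset n → ℕ
degSum {n} X C = ∑[ w < n ] (if lookup C w then deg X w else 0)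

avoids : ∀ {n} → HG n → Subset n → Subset n → ℕ
avoids X C S = ⟦ X S ∧ not (does (nonempty? (C ∩ S))) ⟧

Σs-incidences : ∀ {n} (X : HG n) (C : Subset n) → Σs (incidences X C) ≡ degSum X C
Σs-incidences {n} X C =
  trans (Σs-∑-comm (λ S w → ⟦ lookup (C ∩ S) w ∧ X S ⟧)) (sum-cong-≗ edges-through-C)
  where
  edges-through-C : ∀ w → Σs (λ S → ⟦ lookup (C ∩ S) w ∧ X S ⟧) ≡ (if lookup C w then deg X w else 0)
  edges-through-C w
    rewrite Σs-cong (λ S → cong (λ b → ⟦ b ∧ X S ⟧) (lookup-zipWith _∧_ w C S))
    with lookup C w
  ... | true = sym (deg≡edges-through X w)
  ... | false = Σs-zero {n}

incidences-edge : ∀ {n} (p : Subset n) → ∑[ w < n ] ⟦ lookup p w ∧ true ⟧ ≡ ∣ p ∣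
incidences-edge {n} p = trans (sum-cong-≗ (λ w → cong ⟦_⟧ (∧-identityʳ (lookup p w)))) (sym (∣p∣≡∑ p))

incidences-non-edge : ∀ {n} (p : Subset n) → ∑[ w < n ] ⟦ lookup p w ∧ false ⟧ ≡ 0
incidences-non-edge {n} p = trans (sum-cong-≗ (λ w → cong ⟦_⟧ (∧-zeroʳ (lookup p w)))) (∑-zero n)

edge-≤-avoids+incidences : ∀ {n} (X : HG n) (C S : Subset n) → ⟦ X S ⟧ ≤ avoids X C S + incidences X C S
edge-≤-avoids+incidences X C S with X S | nonempty? (C ∩ S)
... | false | _ = z≤n
... | true | yes meets = ≤-trans (nonempty⇒1≤∣p∣ meets) (≤-reflexive (sym (incidences-edge (C ∩ S))))
... | true | no _ = s≤s z≤n

avoids+incidences-≤-edge : ∀ {n} (X : HG n) (C S : Subset n) → (X S ≡ true → ∣ C ∩ S ∣ ≤ 1) →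
                           avoids X C S + incidences X C S ≤ ⟦ X S ⟧
avoids+incidences-≤-edge X C S atMostOne with X S | nonempty? (C ∩ S)
... | false | _ = ≤-reflexive (incidences-non-edge (C ∩ S))
... | true | yes _ = ≤-trans (≤-reflexive (incidences-edge (C ∩ S))) (atMostOne refl)
... | true | no disjoint =
  s≤s (≤-reflexive (trans (incidences-edge (C ∩ S)) (empty⇒∣p∣≡0 disjoint)))

size-≤-avoiding+degSum : ∀ {n} (X : HG n) (C : Subset n) → size X ≤ Σs (avoids X C) + degSum X C
size-≤-avoiding+degSum X C = begin
  size X                                        ≡⟨ countSub≡Σs X ⟩
  Σs (λ S → ⟦ X S ⟧)                            ≤⟨ Σs-mono (edge-≤-avoids+incidences X C) ⟩
  Σs (λ S → avoids X C S + incidences X C S)    ≡⟨ Σs-distrib-+ (avoids X C) (incidences X C) ⟩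
  Σs (avoids X C) + Σs (incidences X C)         ≡⟨ cong (Σs (avoids X C) +_) (Σs-incidences X C) ⟩
  Σs (avoids X C) + degSum X C                  ∎
  where open ≤-Reasoning

avoiding+degSum-≤-size : ∀ {n} (X : HG n) (C : Subset n) → (∀ S → X S ≡ true → ∣ C ∩ S ∣ ≤ 1) →
                         Σs (avoids X C) + degSum X C ≤ size X
avoiding+degSum-≤-size X C atMostOne = begin
  Σs (avoids X C) + degSum X C                  ≡⟨ cong (Σs (avoids X C) +_) (Σs-incidences X C) ⟨
  Σs (avoids X C) + Σs (incidences X C)         ≡⟨ Σs-distrib-+ (avoids X C) (incidences X C) ⟨
  Σs (λ S → avoids X C S + incidences X C S)    ≤⟨ Σs-mono (λ S → avoids+incidences-≤-edge X C S (atMostOne S)) ⟩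
  Σs (λ S → ⟦ X S ⟧)                            ≡⟨ countSub≡Σs X ⟨
  size X                                        ∎
  where open ≤-Reasoning

avoiding-mono : ∀ {n} (X Y : HG n) (C : Subset n) → (∀ S → X S ≡ true → Empty (C ∩ S) → Y S ≡ true) →
                Σs (avoids X C) ≤ Σs (avoids Y C)
avoiding-mono X Y C kept = Σs-mono pointwise
  where
  pointwise : ∀ S → avoids X C S ≤ avoids Y C S
  pointwise S with X S in edge | nonempty? (C ∩ S)
  ... | false | _ = z≤n
  ... | true | yes _ rewrite ∧-zeroʳ (Y S) = ≤-refl
  ... | true | no disjoint rewrite kept S edge disjoint = ≤-refl

degSum-mono : ∀ {n} (X Y : HG n) (C : Subset n) → (∀ w → w ∈ C → deg X w ≤ deg Y w) →
              degSum X C ≤ degSum Y C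
degSum-mono X Y C deg≤ = ∑-mono pointwise
  where
  pointwise : ∀ w → (if lookup C w then deg X w else 0) ≤ (if lookup C w then deg Y w else 0)
  pointwise w with lookup C w in w∈C
  ... | true = deg≤ w (lookup⇒∈ w∈C)
  ... | false = z≤n

module Step {n} {H H' : HG n} {u v : Fin n} (step : StepWith H u v H') where

  private
    u≁v : ¬ Adj H u v
    u≁v = proj₁ (proj₂ step)
    u≉v : ¬ Equiv H u v
    u≉v = proj₁ (proj₂ (proj₂ step))
    dv≤du : deg H v ≤ deg H u
    dv≤du = proj₁ (proj₂ (proj₂ (proj₂ step)))
    edges : ∀ S → (H' S ≡ true) ⇔
      ((H S ≡ true × ((w : Fin n) → w ∈ S → ¬ InClass H v w))
       ⊎ Σ (Subset n) λ E → H E ≡ true × u ∈ E ×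
           Σ (Fin n) λ v' → InClass H v v' × S ≡ (E - u) ∪ ⁅ v' ⁆)
    edges = proj₂ (proj₂ (proj₂ (proj₂ step)))

  class : Subset n
  class = subsetOf (inClass? H v)

  -- No vertex of C_v is adjacent to u: for v itself by the choice of (u , v);
  -- for an equivalent w, an edge {u,w,..} would give the edge {u,v,..}.
  class-nonadjacent-to-u : ∀ {w} → InClass H v w → ¬ Adj H u w
  class-nonadjacent-to-u (inj₁ refl) = u≁v
  class-nonadjacent-to-u {w} (inj₂ v≈w) (S , edge , u∈S , w∈S) with u ≟ w
  ... | yes refl = u≉v (equiv-sym {X = H} v≈w)
  ... | no u≢w = u≁v ((S - w) ∪ ⁅ v ⁆ , proj₂ v-link , ∈p∪⁅x⁆ v (x∈p∧x≢y⇒x∈p-y u∈S u≢w) , x∈p∪⁅x⁆ (S - w) v)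
    where
    v-link : v ∉ S - w × H ((S - w) ∪ ⁅ v ⁆) ≡ true
    v-link = link⁻ {X = H} (trans (proj₂ (proj₂ v≈w) (S - w)) (edge∈link {X = H} edge w∈S))

  copied-part-avoids-class : ∀ {E w} → H E ≡ true → u ∈ E → InClass H v w → w ∉ E - u
  copied-part-avoids-class {E} edge u∈E v~w w∈ =
    class-nonadjacent-to-u v~w (E , edge , u∈E , p─q⊆p E ⁅ u ⁆ w∈)

  kept-edge : ∀ S → H S ≡ true → Empty (class ∩ S) → H' S ≡ true
  kept-edge S edge disjoint =
    Equivalence.from (edges S) (inj₁ (edge , λ w w∈S v~w → disjoint (w , x∈p∩q⁺ (∈subsetOf⁺ (inClass? H v) v~w , w∈S))))

  copy-shape : ∀ {S w} → H' S ≡ true → w ∈ S → InClass H v w →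
               Σ (Subset n) λ E → H E ≡ true × u ∈ E × S ≡ (E - u) ∪ ⁅ w ⁆
  copy-shape {S} {w} edge w∈S v~w with Equivalence.to (edges S) edge
  ... | inj₁ (_ , avoids-class) = ⊥-elim (avoids-class w w∈S v~w)
  ... | inj₂ (E , E-edge , u∈E , v' , _ , S≡) with ∈p∪⁅x⁆⁻ (E - u) (subst (w ∈_) S≡ w∈S)
  ...   | inj₁ w∈E-u = ⊥-elim (copied-part-avoids-class E-edge u∈E v~w w∈E-u)
  ...   | inj₂ refl = E , E-edge , u∈E , S≡

  one-class-vertex : ∀ S → H' S ≡ true → ∣ class ∩ S ∣ ≤ 1
  one-class-vertex S edge = ∣p∣≤1 unique
    where
    unique : ∀ {a b} → a ∈ class ∩ S → b ∈ class ∩ S → a ≡ b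
    unique {a} {b} a∈ b∈ with x∈p∩q⁻ class S a∈ | x∈p∩q⁻ class S b∈
    ... | a∈C , a∈S | b∈C , b∈S with copy-shape edge a∈S (∈subsetOf⁻ (inClass? H v) a∈C)
    ...   | E , E-edge , u∈E , S≡ with ∈p∪⁅x⁆⁻ (E - u) (subst (b ∈_) S≡ b∈S)
    ...     | inj₁ b∈E-u = ⊥-elim (copied-part-avoids-class E-edge u∈E (∈subsetOf⁻ (inClass? H v) b∈C) b∈E-u)
    ...     | inj₂ b≡a = sym b≡a

  link-of-copy : ∀ {w} → InClass H v w → ∀ P → linkB H' w P ≡ linkB H u P
  link-of-copy {w} v~w P = ⇔→≡ (mk⇔ to from)
    where
    to : linkB H' w P ≡ true → linkB H u P ≡ true
    to inLink with link⁻ {X = H'} inLink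
    ... | w∉P , edge with copy-shape edge (x∈p∪⁅x⁆ P w) v~w
    ...   | E , E-edge , u∈E , P∪w≡ = subst (λ Q → linkB H u Q ≡ true) (sym P≡E-u) (edge∈link {X = H} E-edge u∈E)
      where
      P≡E-u : P ≡ E - u
      P≡E-u = ∪⁅x⁆-cancel w∉P (copied-part-avoids-class E-edge u∈E v~w) P∪w≡
    from : linkB H u P ≡ true → linkB H' w P ≡ true
    from inLink with link⁻ {X = H} inLink
    ... | u∉P , edge = link⁺ {X = H'} w∉P
      (Equivalence.from (edges (P ∪ ⁅ w ⁆)) (inj₂ (P ∪ ⁅ u ⁆ , edge , x∈p∪⁅x⁆ P u , w , v~w , cong (_∪ ⁅ w ⁆) (sym (p∪x-x u∉P)))))
      where
      w∉P : w ∉ P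
      w∉P w∈P = class-nonadjacent-to-u v~w (P ∪ ⁅ u ⁆ , edge , x∈p∪⁅x⁆ P u , ∈p∪⁅x⁆ u w∈P)

  -- Part (a) for one step: d_H(w) = d_H(v) ≤ d_H(u) = d_H'(w) on C_v, so
  -- the double counting gives |H| ≤ |H'|.
  size-≤ : size H ≤ size H'
  size-≤ = begin
    size H                                  ≤⟨ size-≤-avoiding+degSum H class ⟩
    Σs (avoids H class) + degSum H class    ≤⟨ +-mono-≤ (avoiding-mono H H' class kept-edge)
                                                        (degSum-mono H H' class degree-grows) ⟩
    Σs (avoids H' class) + degSum H' class  ≤⟨ avoiding+degSum-≤-size H' class one-class-vertex ⟩
    size H'                                 ∎
    where
    open ≤-Reasoning
    degree-grows : ∀ w → w ∈ class → deg H w ≤ deg H' w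
    degree-grows w w∈C = begin
      deg H w   ≡⟨ sameLink⇒deg≡ {X = H} (sameLink-sym {X = H} (inClass⇒sameLink v~w)) ⟩
      deg H v   ≤⟨ dv≤du ⟩
      deg H u   ≡⟨ countSub-cong (sym ∘ link-of-copy v~w) ⟩
      deg H' w  ∎
      where
      v~w : InClass H v w
      v~w = ∈subsetOf⁻ (inClass? H v) w∈C

  -- A step keeps the graph 3-uniform: a copy (E - u) ∪ {v'} has as many
  -- vertices as E, since v' ∉ E - u and E = (E - u) ∪ {u}.
  preserves-3-graph : Is3Graph H → Is3Graph H'
  preserves-3-graph uniform S edge with Equivalence.to (edges S) edge
  ... | inj₁ (kept , _) = uniform S kept
  ... | inj₂ (E , E-edge , u∈E , v' , v~v' , refl) =
    trans (∣p∪⁅x⁆∣≡1+∣p∣ (E - u) (copied-part-avoids-class E-edge u∈E v~v'))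
          (trans (sym (∣p∪⁅x⁆∣≡1+∣p∣ (E - u) (x∉p-x E u)))
                 (trans (cong ∣_∣ (p-x∪x u∈E)) (uniform E E-edge)))

run : ∀ {n} {H Ht : HG n} → Reaches H Ht → Is3Graph H → size H ≤ size Ht × Is3Graph Ht
run ε uniform = ≤-refl , uniform
run ((_ , _ , step) ◅ rest) uniform with run rest (Step.preserves-3-graph step uniform)
... | size≤ , uniformₜ = ≤-trans (Step.size-≤ step) size≤ , uniformₜ

module Blowup {n} (G : HG n) (T : Subset n) (uniform : Is3Graph G) (stopped : Stopped G)
              (transversal : IsTransversal G T) where

  rep : Fin n → Fin n
  rep x = proj₁ (proj₁ transversal x)

  rep∈T : ∀ x → rep x ∈ T
  rep∈T x = proj₁ (proj₂ (proj₁ transversal x))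

  rep-link : ∀ x → SameLink G x (rep x)
  rep-link x = inClass⇒sameLink (proj₂ (proj₂ (proj₁ transversal x)))

  rep-fixes-T : ∀ {i} → i ∈ T → rep i ≡ i
  rep-fixes-T {i} i∈T = sym (proj₂ transversal i (rep i) i∈T (rep∈T i) (proj₂ (proj₂ (proj₁ transversal i))))

  -- S is covered by an edge E of G[T] with rep mapping S onto E
  -- (the right-hand side of the blowup condition).
  Covered : Subset n → Set
  Covered S = Σ (Subset n) λ E → Induced G T E × ∣ E ∣ ≡ 3 × ∣ S ∣ ≡ 3 ×
              ((x : Fin n) → x ∈ S → rep x ∈ E) ×
              ((i : Fin n) → i ∈ E → Σ (Fin n) λ x → x ∈ S × rep x ≡ i)

  edge⇒covered : ∀ S → G S ≡ true → Covered S
  edge⇒covered S edge with 3-set⇒triple {S = S} (uniform S edge)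
  ... | x , y , z , distinct , refl with replace-all {X = G} edge distinct (rep-link x) (rep-link y) (rep-link z)
  ...   | rep-edge , rep-distinct =
    triple (rep x) (rep y) (rep z) , (rep-edge , inT) , ∣triple∣≡3 rep-distinct , uniform S edge ,
    (λ w → triple-map rep) , (λ i → triple-map⁻ rep)
    where
    inT : triple (rep x) (rep y) (rep z) ⊆ T
    inT i∈ with triple-map⁻ rep i∈
    ... | w , _ , refl = rep∈T w

  -- Conversely, a covered 3-set {x,y,z} is an edge, since its cover is
  -- {rep x, rep y, rep z}.
  covered⇒edge : ∀ S → Covered S → G S ≡ true
  covered⇒edge S (E , (E-edge , _) , ∣E∣≡3 , ∣S∣≡3 , maps-into , onto) with 3-set⇒triple {S = S} ∣S∣≡3
  ... | x , y , z , _ , refl =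
    proj₁ (replace-all {X = G} rep-edge (∣triple∣≡3⇒distinct (trans (cong ∣_∣ (sym E≡)) ∣E∣≡3))
                       (back x) (back y) (back z))
    where
    E≡ : E ≡ triple (rep x) (rep y) (rep z)
    E≡ = ⊆-antisym (λ i∈E → image (onto _ i∈E))
                   (λ i∈ → image′ (triple-map⁻ rep i∈))
      where
      image : ∀ {i} → Σ (Fin n) (λ w → w ∈ triple x y z × rep w ≡ i) → i ∈ triple (rep x) (rep y) (rep z)
      image (w , w∈ , refl) = triple-map rep w∈
      image′ : ∀ {i} → Σ (Fin n) (λ w → w ∈ triple x y z × rep w ≡ i) → i ∈ E
      image′ (w , w∈ , refl) = maps-into w w∈
    rep-edge : G (triple (rep x) (rep y) (rep z)) ≡ true
    rep-edge = subst (λ F → G F ≡ true) E≡ E-edge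
    back : ∀ w → SameLink G (rep w) w
    back w = sameLink-sym {X = G} (rep-link w)

  is-blowup : IsBlowupOf G T (Induced G T)
  is-blowup = rep , rep∈T , (λ i i∈T → i , rep-fixes-T i∈T) , (λ S → mk⇔ (edge⇒covered S) (covered⇒edge S))

  -- Distinct vertices of T lie in different classes, so (G being stopped)
  -- they are adjacent; the cover of an edge through both lies in G[T].
  two-covered : TwoCovered T (Induced G T)
  two-covered a b a∈T b∈T a≢b with adjacent? G a b
  ... | no a≁b = ⊥-elim (a≢b (proj₂ transversal a b a∈T b∈T (inj₂ (stopped a b a≢b a≁b))))
  ... | yes (S , edge , a∈S , b∈S) with edge⇒covered S edge
  ...   | E , inducedE , _ , _ , maps-into , _ =
    E , inducedE , subst (_∈ E) (rep-fixes-T a∈T) (maps-into a a∈S) , subst (_∈ E) (rep-fixes-T b∈T) (maps-into b b∈S)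

lemma4p6 : {n : ℕ} (H Ht : HG n) (T : Subset n) →
    Is3Graph H → Reaches H Ht → Stopped Ht → IsTransversal Ht T →
    (size H ≤ size Ht) ×
    (TwoCovered T (Induced Ht T) × IsBlowupOf Ht T (Induced Ht T))
lemma4p6 H Ht T uniform reaches stopped transversal with run reaches uniform
... | size≤ , uniformₜ =
  size≤ , Blowup.two-covered Ht T uniformₜ stopped transversal , Blowup.is-blowup Ht T uniformₜ stopped transversal
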